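{- Let $n>1$ be an integer, $p$ a prime dividing $n$, and $g_1(x),g_2(x)\in\mathbb{Z}[x]$ monic polynomials. If $f(x)=\operatorname{gcmd}(g_1(x),g_2(x))$ in $(\mathbb{Z}/n\mathbb{Z})[x]$, then $f(x)\equiv \gcd(g_1(x),g_2(x)) \pmod p$, where the (monic) $\gcd$ is taken in $(\mathbb{Z}/p\mathbb{Z})[x]$.
   Context: For monic polynomials $g_1,g_2$ over a commutative ring $R$ with identity, a monic polynomial $h\in R[x]$ is the greatest common monic divisor of $g_1$ and $g_2$, written $h=\operatorname{gcmd}(g_1,g_2)$, if the ideal of $R[x]$ generated by $g_1$ and $g_2$ equals the ideal generated by $h$. (It need not exist.) -}

module Defs where

open import Data.Nat using (ℕ; zero; suc; _<_)
open import Data.Integer using (ℤ; +_; _+_; _*_; _-_)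
open import Data.Integer.Divisibility using (_∣_)
open import Data.List using (List; []; _∷_; map)
open import Data.Product using (Σ; ∃; _×_)
open import Relation.Binary.PropositionalEquality using (_≡_)

-- Polynomials with integer coefficients, as coefficient lists,
-- lowest degree first:  a₀ ∷ a₁ ∷ … represents a₀ + a₁ x + …
Poly : Set
Poly = List ℤ

coeff : Poly → ℕ → ℤ
coeff []       _       = + 0
coeff (a ∷ _)  zero    = a
coeff (_ ∷ as) (suc j) = coeff as j

infixl 6 _+ₚ_
infixl 7 _*ₚ_ _·ₚ_

_+ₚ_ : Poly → Poly → Poly
[]       +ₚ q        = q
(a ∷ as) +ₚ []       = a ∷ as
(a ∷ as) +ₚ (b ∷ bs) = (a + b) ∷ (as +ₚ bs)

_·ₚ_ : ℤ → Poly → Poly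
c ·ₚ q = map (c *_) q

_*ₚ_ : Poly → Poly → Poly
[]       *ₚ q = []
(a ∷ as) *ₚ q = (a ·ₚ q) +ₚ (+ 0 ∷ (as *ₚ q))

Monic : Poly → Set
Monic g = ∃ λ d → coeff g d ≡ + 1 × (∀ j → d < j → coeff g j ≡ + 0)

-- congruence of polynomials modulo m (coefficientwise), i.e. equality
-- of their images in (ℤ/mℤ)[x]
_≡ₚ_[mod_] : Poly → Poly → ℕ → Set
a ≡ₚ b [mod m ] = ∀ j → + m ∣ (coeff a j - coeff b j)

MonicMod : ℕ → Poly → Set
MonicMod m g = ∃ λ d → (+ m ∣ (coeff g d - + 1)) × (∀ j → d < j → + m ∣ coeff g j)

DividesMod : ℕ → Poly → Poly → Set
DividesMod m a b = ∃ λ c → b ≡ₚ c *ₚ a [mod m ]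

InIdeal₂ : ℕ → Poly → Poly → Poly → Set
InIdeal₂ m h g₁ g₂ = ∃ λ u → ∃ λ v → h ≡ₚ u *ₚ g₁ +ₚ v *ₚ g₂ [mod m ]

-- h = gcmd(g₁, g₂) in (ℤ/mℤ)[x]: h is monic and the ideal (g₁, g₂)
-- equals the principal ideal (h)
IsGcmd : ℕ → Poly → Poly → Poly → Set
IsGcmd m h g₁ g₂ =
  MonicMod m h × InIdeal₂ m h g₁ g₂ × DividesMod m h g₁ × DividesMod m h g₂

IsMonicGcdMod : ℕ → Poly → Poly → Poly → Set
IsMonicGcdMod p d g₁ g₂ =
  MonicMod p d × DividesMod p d g₁ × DividesMod p d g₂ ×
  (∀ e → DividesMod p e g₁ → DividesMod p e g₂ → DividesMod p e d)

{-# OPTIONS --safe #-}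
module Submission where

-- The ideal (g₁, g₂) = (f) of (ℤ/nℤ)[x] maps onto the ideal (g₁, g₂) of
-- (ℤ/pℤ)[x], so f stays a monic common divisor of g₁ and g₂ modulo p and
-- still lies in their ideal: f = u g₁ + v g₂.  Any common divisor e,
-- with g₁ = k₁ e and g₂ = k₂ e, then divides f = (u k₁ + v k₂) e.

open import Defs
open import Data.Nat using (ℕ; zero; suc; _<_)
open import Data.Nat.Divisibility using (_∣_; ∣-trans)
open import Data.Nat.Primality using (Prime)
open import Data.Integer using (+_; -_; _+_; _*_; _-_)
open import Data.Integer.Properties using (+-identityˡ; +-identityʳ; *-zeroˡ; *-zeroʳ; +-inverseʳ)
import Data.Integer.Divisibility.Signed as Signed
open import Data.Integer.Tactic.RingSolver using (solve-∀)
open import Data.List using ([]; _∷_)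
open import Data.Product using (_,_)
open import Function using (_∘_)
open import Relation.Binary.Bundles using (Setoid)
open import Relation.Binary.Structures using (IsEquivalence)
open import Relation.Binary.PropositionalEquality
  using (_≡_; _≗_; refl; sym; trans; cong; cong₂; subst; module ≡-Reasoning)
import Relation.Binary.Reasoning.Setoid as SetoidReasoning

coeff-+ₚ : ∀ a b j → coeff (a +ₚ b) j ≡ coeff a j + coeff b j
coeff-+ₚ []       b        j       = sym (+-identityˡ _)
coeff-+ₚ (x ∷ xs) []       j       = sym (+-identityʳ _)
coeff-+ₚ (x ∷ xs) (y ∷ ys) zero    = refl
coeff-+ₚ (x ∷ xs) (y ∷ ys) (suc j) = coeff-+ₚ xs ys j

coeff-·ₚ : ∀ c a j → coeff (c ·ₚ a) j ≡ c * coeff a j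
coeff-·ₚ c []       j       = sym (*-zeroʳ c)
coeff-·ₚ c (x ∷ xs) zero    = refl
coeff-·ₚ c (x ∷ xs) (suc j) = coeff-·ₚ c xs j

coeff-∷-*ₚ : ∀ x xs q j → coeff ((x ∷ xs) *ₚ q) j ≡ x * coeff q j + coeff (+ 0 ∷ xs *ₚ q) j
coeff-∷-*ₚ x xs q j = trans (coeff-+ₚ (x ·ₚ q) _ j) (cong (_+ _) (coeff-·ₚ x q j))

coeff-∷-cong : ∀ x {a b} → coeff a ≗ coeff b → coeff (x ∷ a) ≗ coeff (x ∷ b)
coeff-∷-cong x a≗b zero    = refl
coeff-∷-cong x a≗b (suc j) = a≗b j

coeff-0∷-+ₚ : ∀ a b j → coeff (+ 0 ∷ a +ₚ b) j ≡ coeff (+ 0 ∷ a) j + coeff (+ 0 ∷ b) j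
coeff-0∷-+ₚ a b zero    = refl
coeff-0∷-+ₚ a b (suc j) = coeff-+ₚ a b j

coeff-0∷-·ₚ : ∀ c a j → coeff (+ 0 ∷ c ·ₚ a) j ≡ c * coeff (+ 0 ∷ a) j
coeff-0∷-·ₚ c a zero    = sym (*-zeroʳ c)
coeff-0∷-·ₚ c a (suc j) = coeff-·ₚ c a j

coeff-0∷-*ₚ : ∀ a q j → coeff ((+ 0 ∷ a) *ₚ q) j ≡ coeff (+ 0 ∷ a *ₚ q) j
coeff-0∷-*ₚ a q j = begin
  coeff ((+ 0 ∷ a) *ₚ q) j                  ≡⟨ coeff-∷-*ₚ (+ 0) a q j ⟩
  + 0 * coeff q j + coeff (+ 0 ∷ a *ₚ q) j  ≡⟨ cong (_+ coeff (+ 0 ∷ a *ₚ q) j) (*-zeroˡ (coeff q j)) ⟩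
  + 0 + coeff (+ 0 ∷ a *ₚ q) j              ≡⟨ +-identityˡ _ ⟩
  coeff (+ 0 ∷ a *ₚ q) j                    ∎
  where open ≡-Reasoning

coeff-*ₚ-distribʳ-+ₚ : ∀ a b c → coeff ((a +ₚ b) *ₚ c) ≗ coeff (a *ₚ c +ₚ b *ₚ c)
coeff-*ₚ-distribʳ-+ₚ []       b        c j = refl
coeff-*ₚ-distribʳ-+ₚ (x ∷ xs) []       c j = sym (trans (coeff-+ₚ ((x ∷ xs) *ₚ c) [] j) (+-identityʳ _))
coeff-*ₚ-distribʳ-+ₚ (x ∷ xs) (y ∷ ys) c j = begin
  coeff ((x + y ∷ xs +ₚ ys) *ₚ c) j
    ≡⟨ coeff-∷-*ₚ (x + y) (xs +ₚ ys) c j ⟩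
  (x + y) * coeff c j + coeff (+ 0 ∷ (xs +ₚ ys) *ₚ c) j
    ≡⟨ cong (_+_ ((x + y) * coeff c j))
            (trans (coeff-∷-cong (+ 0) (coeff-*ₚ-distribʳ-+ₚ xs ys c) j) (coeff-0∷-+ₚ (xs *ₚ c) (ys *ₚ c) j)) ⟩
  (x + y) * coeff c j + (coeff (+ 0 ∷ xs *ₚ c) j + coeff (+ 0 ∷ ys *ₚ c) j)
    ≡⟨ interchange x y (coeff c j) _ _ ⟩
  (x * coeff c j + coeff (+ 0 ∷ xs *ₚ c) j) + (y * coeff c j + coeff (+ 0 ∷ ys *ₚ c) j)
    ≡⟨ sym (cong₂ _+_ (coeff-∷-*ₚ x xs c j) (coeff-∷-*ₚ y ys c j)) ⟩
  coeff ((x ∷ xs) *ₚ c) j + coeff ((y ∷ ys) *ₚ c) j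
    ≡⟨ sym (coeff-+ₚ ((x ∷ xs) *ₚ c) _ j) ⟩
  coeff ((x ∷ xs) *ₚ c +ₚ (y ∷ ys) *ₚ c) j ∎
  where
  open ≡-Reasoning
  interchange : ∀ x y z s t → (x + y) * z + (s + t) ≡ (x * z + s) + (y * z + t)
  interchange = solve-∀

coeff-·ₚ-*ₚ-assoc : ∀ x b c → coeff ((x ·ₚ b) *ₚ c) ≗ coeff (x ·ₚ (b *ₚ c))
coeff-·ₚ-*ₚ-assoc x []       c j = refl
coeff-·ₚ-*ₚ-assoc x (y ∷ ys) c j = begin
  coeff ((x * y ∷ x ·ₚ ys) *ₚ c) j
    ≡⟨ coeff-∷-*ₚ (x * y) (x ·ₚ ys) c j ⟩
  x * y * coeff c j + coeff (+ 0 ∷ (x ·ₚ ys) *ₚ c) j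
    ≡⟨ cong (_+_ (x * y * coeff c j))
            (trans (coeff-∷-cong (+ 0) (coeff-·ₚ-*ₚ-assoc x ys c) j) (coeff-0∷-·ₚ x (ys *ₚ c) j)) ⟩
  x * y * coeff c j + x * coeff (+ 0 ∷ ys *ₚ c) j
    ≡⟨ factor x y (coeff c j) _ ⟩
  x * (y * coeff c j + coeff (+ 0 ∷ ys *ₚ c) j)
    ≡⟨ cong (x *_) (sym (coeff-∷-*ₚ y ys c j)) ⟩
  x * coeff ((y ∷ ys) *ₚ c) j
    ≡⟨ sym (coeff-·ₚ x ((y ∷ ys) *ₚ c) j) ⟩
  coeff (x ·ₚ ((y ∷ ys) *ₚ c)) j ∎
  where
  open ≡-Reasoning
  factor : ∀ x y z t → x * y * z + x * t ≡ x * (y * z + t)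
  factor = solve-∀

coeff-*ₚ-assoc : ∀ a b c → coeff ((a *ₚ b) *ₚ c) ≗ coeff (a *ₚ (b *ₚ c))
coeff-*ₚ-assoc []       b c j = refl
coeff-*ₚ-assoc (x ∷ xs) b c j = begin
  coeff ((x ·ₚ b +ₚ (+ 0 ∷ xs *ₚ b)) *ₚ c) j
    ≡⟨ coeff-*ₚ-distribʳ-+ₚ (x ·ₚ b) (+ 0 ∷ xs *ₚ b) c j ⟩
  coeff ((x ·ₚ b) *ₚ c +ₚ (+ 0 ∷ xs *ₚ b) *ₚ c) j
    ≡⟨ coeff-+ₚ ((x ·ₚ b) *ₚ c) _ j ⟩
  coeff ((x ·ₚ b) *ₚ c) j + coeff ((+ 0 ∷ xs *ₚ b) *ₚ c) j
    ≡⟨ cong₂ _+_ (coeff-·ₚ-*ₚ-assoc x b c j)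
                 (trans (coeff-0∷-*ₚ (xs *ₚ b) c j) (coeff-∷-cong (+ 0) (coeff-*ₚ-assoc xs b c) j)) ⟩
  coeff (x ·ₚ (b *ₚ c)) j + coeff (+ 0 ∷ xs *ₚ (b *ₚ c)) j
    ≡⟨ sym (coeff-+ₚ (x ·ₚ (b *ₚ c)) _ j) ⟩
  coeff ((x ∷ xs) *ₚ (b *ₚ c)) j ∎
  where open ≡-Reasoning

-- Signed divisibility, so that the lemmas of Data.Integer.Divisibility.Signed
-- apply; the record lets Agda infer both polynomials from a proof.
module Modulo (m : ℕ) where

  infix 4 _≈_

  record _≈_ (a b : Poly) : Set where
    constructor coeffwise
    field ∣coeff-coeff : ∀ j → + m Signed.∣ coeff a j - coeff b j
  open _≈_

  fromCongruence : ∀ {a b} → a ≡ₚ b [mod m ] → a ≈ b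
  fromCongruence a≡b = coeffwise (Signed.∣ᵤ⇒∣ ∘ a≡b)

  toCongruence : ∀ {a b} → a ≈ b → a ≡ₚ b [mod m ]
  toCongruence a≈b = Signed.∣⇒∣ᵤ ∘ ∣coeff-coeff a≈b

  ≗⇒≈ : ∀ {a b} → coeff a ≗ coeff b → a ≈ b
  ≗⇒≈ {a} {b} a≗b = coeffwise λ j →
    subst (+ m Signed.∣_) (sym (trans (cong (_- coeff b j) (a≗b j)) (+-inverseʳ (coeff b j))))
      (Signed.divides (+ 0) refl)

  ≈-refl : ∀ {a} → a ≈ a
  ≈-refl = ≗⇒≈ λ _ → refl

  ≈-sym : ∀ {a b} → a ≈ b → b ≈ a
  ≈-sym {a} {b} a≈b = coeffwise λ j →
    subst (+ m Signed.∣_) (negate-difference (coeff a j) (coeff b j))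
      (Signed.∣m⇒∣-m (∣coeff-coeff a≈b j))
    where
    negate-difference : ∀ x y → - (x - y) ≡ y - x
    negate-difference = solve-∀

  ≈-trans : ∀ {a b c} → a ≈ b → b ≈ c → a ≈ c
  ≈-trans {a} {b} {c} a≈b b≈c = coeffwise λ j →
    subst (+ m Signed.∣_) (telescope (coeff a j) (coeff b j) (coeff c j))
      (Signed.∣m∣n⇒∣m+n (∣coeff-coeff a≈b j) (∣coeff-coeff b≈c j))
    where
    telescope : ∀ x y z → (x - y) + (y - z) ≡ x - z
    telescope = solve-∀

  ≈-isEquivalence : IsEquivalence _≈_
  ≈-isEquivalence = record { refl = ≈-refl ; sym = ≈-sym ; trans = ≈-trans }

  ≈-setoid : Setoid _ _
  ≈-setoid = record { isEquivalence = ≈-isEquivalence }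

  +ₚ-cong : ∀ {a a′ b b′} → a ≈ a′ → b ≈ b′ → a +ₚ b ≈ a′ +ₚ b′
  +ₚ-cong {a} {a′} {b} {b′} a≈a′ b≈b′ = coeffwise λ j →
    subst (+ m Signed.∣_)
      (trans (regroup (coeff a j) (coeff b j) (coeff a′ j) (coeff b′ j))
             (sym (cong₂ _-_ (coeff-+ₚ a b j) (coeff-+ₚ a′ b′ j))))
      (Signed.∣m∣n⇒∣m+n (∣coeff-coeff a≈a′ j) (∣coeff-coeff b≈b′ j))
    where
    regroup : ∀ x y x′ y′ → (x - x′) + (y - y′) ≡ (x + y) - (x′ + y′)
    regroup = solve-∀

  ∷-congʳ : ∀ x {a b} → a ≈ b → x ∷ a ≈ x ∷ b
  ∷-congʳ x {a} a≈b = coeffwise λ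
    { zero    → ∣coeff-coeff (≈-refl {x ∷ a}) zero
    ; (suc j) → ∣coeff-coeff a≈b j }

  ·ₚ-congˡ : ∀ c {a b} → a ≈ b → c ·ₚ a ≈ c ·ₚ b
  ·ₚ-congˡ c {a} {b} a≈b = coeffwise λ j →
    subst (+ m Signed.∣_)
      (trans (distrib c (coeff a j) (coeff b j)) (sym (cong₂ _-_ (coeff-·ₚ c a j) (coeff-·ₚ c b j))))
      (Signed.∣n⇒∣m*n c (∣coeff-coeff a≈b j))
    where
    distrib : ∀ x y z → x * (y - z) ≡ x * y - x * z
    distrib = solve-∀

  *ₚ-congˡ : ∀ a {b c} → b ≈ c → a *ₚ b ≈ a *ₚ c
  *ₚ-congˡ []       b≈c = ≈-refl
  *ₚ-congˡ (x ∷ xs) b≈c = +ₚ-cong (·ₚ-congˡ x b≈c) (∷-congʳ (+ 0) (*ₚ-congˡ xs b≈c))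

  *ₚ-assoc : ∀ a b c → a *ₚ b *ₚ c ≈ a *ₚ (b *ₚ c)
  *ₚ-assoc a b c = ≗⇒≈ (coeff-*ₚ-assoc a b c)

  *ₚ-distribʳ-+ₚ : ∀ a b c → (a +ₚ b) *ₚ c ≈ a *ₚ c +ₚ b *ₚ c
  *ₚ-distribʳ-+ₚ a b c = ≗⇒≈ (coeff-*ₚ-distribʳ-+ₚ a b c)

  dividesMod-inIdeal₂ : ∀ h g₁ g₂ e → InIdeal₂ m h g₁ g₂ →
    DividesMod m e g₁ → DividesMod m e g₂ → DividesMod m e h
  dividesMod-inIdeal₂ h g₁ g₂ e (u , v , h≡) (k₁ , g₁≡) (k₂ , g₂≡) =
    u *ₚ k₁ +ₚ v *ₚ k₂ , toCongruence (begin
      h                                 ≈⟨ fromCongruence h≡ ⟩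
      u *ₚ g₁ +ₚ v *ₚ g₂                ≈⟨ +ₚ-cong (*ₚ-congˡ u (fromCongruence g₁≡))
                                                   (*ₚ-congˡ v (fromCongruence g₂≡)) ⟩
      u *ₚ (k₁ *ₚ e) +ₚ v *ₚ (k₂ *ₚ e)  ≈⟨ ≈-sym (+ₚ-cong (*ₚ-assoc u k₁ e) (*ₚ-assoc v k₂ e)) ⟩
      u *ₚ k₁ *ₚ e +ₚ v *ₚ k₂ *ₚ e      ≈⟨ ≈-sym (*ₚ-distribʳ-+ₚ (u *ₚ k₁) (v *ₚ k₂) e) ⟩
      (u *ₚ k₁ +ₚ v *ₚ k₂) *ₚ e         ∎)
    where open SetoidReasoning ≈-setoid

module _ {m k : ℕ} (k∣m : k ∣ m) where

  ≡ₚ-mod-∣ : ∀ a b → a ≡ₚ b [mod m ] → a ≡ₚ b [mod k ]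
  ≡ₚ-mod-∣ a b a≡b j = ∣-trans k∣m (a≡b j)

  monicMod-∣ : ∀ g → MonicMod m g → MonicMod k g
  monicMod-∣ g (d , lead , above) = d , ∣-trans k∣m lead , λ j d<j → ∣-trans k∣m (above j d<j)

  dividesMod-∣ : ∀ a b → DividesMod m a b → DividesMod k a b
  dividesMod-∣ a b (c , b≡) = c , ≡ₚ-mod-∣ b (c *ₚ a) b≡

  inIdeal₂-∣ : ∀ h g₁ g₂ → InIdeal₂ m h g₁ g₂ → InIdeal₂ k h g₁ g₂
  inIdeal₂-∣ h g₁ g₂ (u , v , h≡) = u , v , ≡ₚ-mod-∣ h (u *ₚ g₁ +ₚ v *ₚ g₂) h≡

  isGcmd⇒isMonicGcdMod : ∀ f g₁ g₂ → IsGcmd m f g₁ g₂ → IsMonicGcdMod k f g₁ g₂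
  isGcmd⇒isMonicGcdMod f g₁ g₂ (monic , inIdeal , f∣g₁ , f∣g₂) =
    monicMod-∣ f monic , dividesMod-∣ f g₁ f∣g₁ , dividesMod-∣ f g₂ f∣g₂ ,
    λ e → Modulo.dividesMod-inIdeal₂ k f g₁ g₂ e (inIdeal₂-∣ f g₁ g₂ inIdeal)

proposition3p2 : (n p : ℕ) → 1 < n → Prime p → p ∣ n →
    (g₁ g₂ f : Poly) → Monic g₁ → Monic g₂ →
    IsGcmd n f g₁ g₂ →
    IsMonicGcdMod p f g₁ g₂
proposition3p2 n p _ _ p∣n g₁ g₂ f _ _ = isGcmd⇒isMonicGcdMod p∣n f g₁ g₂
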